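{- The $abc$ conjecture implies the $S$-integral weak Hall conjecture, i.e.\ the statement that for every finite set of rational primes $S$, every nonzero integer $D$ and every $\varepsilon>0$, any $S$-primitive solution $(x,y)$ of the equation \[ y^2 = x^3 + aD,\qquad x,y\in \mathbb{Z}, \quad a\in\mathbb{Z}\cap\mathcal{O}_S^\times, \] satisfies \[ \max(|x|^{1/2},|y|^{1/3}) = O_\varepsilon((N_SD)^{1+\varepsilon}). \] More explicitly, if the $abc$ conjecture holds for some $0<\varepsilon\leq 0.1$ with constant $K_\varepsilon$, then any $S$-primitive solution $(x,y)$ of the equation $y^2 = x^3 + aD$ with $x,y\in \mathbb{Z}$ and $a\in\mathbb{Z}\cap\mathcal{O}_S^\times$ satisfies \[ \max(|x|^{1/2},|y|^{1/3}) \leq K_\varepsilon^{1+10\varepsilon}(N_SD)^{1+12\varepsilon}. \]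
   Context: Let $S$ be a finite set of rational primes, $N_S=\prod_{p\in S}p$, $\mathcal{O}_S=\mathbb{Z}[1/N_S]$ the ring of $S$-integers and $\mathcal{O}_S^\times$ its group of units ($S$-units). Let $D\neq 0$ be an integer. A pair of integers $(x,y)$ is called $S$-primitive if there is no $p\in S$ such that $p^6$ divides both $x^3$ and $y^2$. The $abc$ conjecture states: for any $\varepsilon>0$ there is a constant $K_\varepsilon$ (depending only on $\varepsilon$) such that for all coprime integers $a,b,c$ with $a+b+c=0$ one has $\max(|a|,|b|,|c|)\leq K_\varepsilon\,\mathrm{rad}(abc)^{1+\varepsilon}$, where $\mathrm{rad}(abc)=\prod_{p\mid abc}p$.
   Formalization: The exponent ε with $0<\varepsilon\leq 0.1$ ranges over the rationals only, and the abc constant $K_\varepsilon$ is taken to be a positive rational. -}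

module Defs where

open import Data.Nat as ℕ using (ℕ; _≤_; _⊔_; suc)
open import Data.Nat.Divisibility using (_∣_; _∣?_)
open import Data.Nat.Primality using (Prime; prime?)
open import Data.Nat.GCD using (gcd)
open import Data.Integer as ℤ using (ℤ; ∣_∣; 0ℤ)
open import Data.List using (List; filter; upTo)
open import Data.Nat.ListAction using (product)
open import Data.List.Membership.Propositional using (_∈_)
open import Data.Product using (_×_; ∃)
open import Relation.Nullary using (¬_)
open import Relation.Nullary.Decidable using (_×-dec_)
open import Relation.Binary.PropositionalEquality using (_≡_; _≢_)

rad : ℕ → ℕ
rad n = product (filter (λ p → prime? p ×-dec (p ∣? n)) (upTo (suc n)))

-- N_S = ∏_{p ∈ S} p   (S given as a duplicate-free list of primes)
NS : List ℕ → ℕ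
NS S = product S

-- a ∈ ℤ ∩ 𝒪_S^× : a nonzero integer all of whose prime divisors lie in S
SUnitInt : List ℕ → ℤ → Set
SUnitInt S a = (a ≢ 0ℤ) × (∀ r → Prime r → r ∣ ∣ a ∣ → r ∈ S)

SPrimitive : List ℕ → ℤ → ℤ → Set
SPrimitive S x y =
  ¬ (∃ λ p → p ∈ S × (p ℕ.^ 6 ∣ ∣ x ∣ ℕ.^ 3) × (p ℕ.^ 6 ∣ ∣ y ∣ ℕ.^ 2))

-- The abc conjecture for ε = e/q (rational) with constant K = kn/kd (positive rational):
-- for all nonzero coprime integers a,b,c with a+b+c = 0,
--   max(|a|,|b|,|c|) ≤ K · rad(abc)^(1+ε),
-- written after raising both sides to the q-th power and clearing denominators:
--   max^q · kd^q ≤ kn^q · rad(abc)^(q+e).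
ABC : (e q kn kd : ℕ) → Set
ABC e q kn kd =
  ∀ (a b c : ℤ) → a ≢ 0ℤ → b ≢ 0ℤ → c ≢ 0ℤ →
  gcd (gcd ∣ a ∣ ∣ b ∣) ∣ c ∣ ≡ 1 →
  a ℤ.+ b ℤ.+ c ≡ 0ℤ →
  ((∣ a ∣ ⊔ ∣ b ∣ ⊔ ∣ c ∣) ℕ.^ q) ℕ.* (kd ℕ.^ q)
    ≤ (kn ℕ.^ q) ℕ.* (rad ∣ a ℤ.* b ℤ.* c ∣ ℕ.^ (q ℕ.+ e))

{-# OPTIONS --safe #-}
-- Write g = gcd (x³, y²), so that x³ = a′g, y² = b′g and aD = c′g with a′, b′ coprime.
-- abc for (a′, −b′, c′) bounds Z = max (|x|³, |y|²) by K (g · rad (a′b′c′)) ^ (1 + ε), and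
-- comparing valuations prime by prime (S-primitivity at the primes of S, a ∈ 𝒪_S^× at the
-- others) shows g · rad (a′b′c′) ∣ x y N_S D.  As |xy|⁶ ≤ Z⁵, the factor xy is absorbed:
-- Z ^ (1 − 5ε) ≤ K⁶ (N_S D) ^ (6 (1 + ε)); the bounds on |x| ≤ Z ^ (1/3) and |y| ≤ Z ^ (1/2)
-- follow by taking roots, rounding exponents of K up, which is allowed because abc for
-- 1 + 8 = 9 forces K ≥ 1.  If x or y vanishes, the equation alone gives |y| ∣ (N_S D)² or
-- |x| ∣ N_S D.
module Submission where

open import Defs
open import Data.Nat as ℕ
open import Data.Nat.Properties
open import Data.Nat.Divisibility
open import Data.Nat.Primality
open import Data.Nat.GCD
open import Data.Nat.ListAction using (product)
open import Data.Nat.ListAction.Properties using (∈⇒∣product)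
open import Data.Nat.Primality.Factorisation
  using (PrimeFactorisation; factorise; factorisationHasAllPrimeFactors)
open import Data.Nat.Tactic.RingSolver using (solve-∀)
open import Data.Integer as ℤ using (ℤ; ∣_∣; 0ℤ; -_; _-_)
import Data.Integer.Properties as ℤ
import Data.Integer.Divisibility.Signed as ℤ∣
import Data.Integer.Tactic.RingSolver as ℤ-Solver
open import Data.List using (List; []; _∷_; filter; upTo)
open import Data.List.Relation.Unary.All using (All; []; _∷_)
import Data.List.Relation.Unary.All as All
import Data.List.Relation.Unary.All.Properties as All
open import Data.List.Relation.Unary.AllPairs using ([]; _∷_)
open import Data.List.Relation.Unary.Unique.Propositional using (Unique)
import Data.List.Relation.Unary.Unique.Propositional.Properties as Unique
open import Data.Product using (∃-syntax; _×_; _,_; proj₁; proj₂; map)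
open import Data.Sum using (inj₁; inj₂)
open import Data.Unit using (tt)
open import Function using (_∘_; _$_)
open import Relation.Nullary using (¬_; Dec; yes; no; contradiction)
open import Relation.Nullary.Decidable using (_×-dec_)
open import Relation.Binary.PropositionalEquality

private variable
  p k j m n : ℕ

*-≢0 : m ≢ 0 → n ≢ 0 → m * n ≢ 0
*-≢0 {m} m≢0 n≢0 mn≡0 with m*n≡0⇒m≡0∨n≡0 m mn≡0
... | inj₁ m≡0 = m≢0 m≡0
... | inj₂ n≡0 = n≢0 n≡0

^-≢0 : ∀ k → m ≢ 0 → m ^ k ≢ 0
^-≢0 {m} k m≢0 = m≢0 ∘ m^n≡0⇒m≡0 m k

prime≢0 : Prime p → p ≢ 0
prime≢0 {suc _} _ ()

prime∤1 : Prime p → p ∤ 1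
prime∤1 {suc (suc _)} _ p∣1 with ∣1⇒≡1 p∣1
... | ()

-- p-adic valuations

-- Repeated division with fuel; fuel n suffices since each division decreases n.
-- Junk value: ν p 0 = 0.
ν′ : ℕ → ℕ → ℕ → ℕ
ν′ zero    p n = 0
ν′ (suc f) p n with p ∣? n
... | no  _   = 0
... | yes p∣n = suc (ν′ f p (quotient p∣n))

ν : ℕ → ℕ → ℕ
ν p n = ν′ n p n

ν′-decomposition : ∀ f → Prime p → n ≢ 0 → n ≤ f →
  ∃[ m ] n ≡ p ^ ν′ f p n * m × p ∤ m
ν′-decomposition zero _ n≢0 n≤0 = contradiction (n≤0⇒n≡0 n≤0) n≢0
ν′-decomposition {p} {n} (suc f) pp n≢0 n≤f with p ∣? n
... | no  p∤n = n , sym (+-identityʳ n) , p∤n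
... | yes p∣n@(divides n′ n≡n′p)
  with ν′-decomposition f pp n′≢0 (<⇒≤pred (≤-trans n′<n n≤f))
  where
  n′≢0 : n′ ≢ 0
  n′≢0 n′≡0 = n≢0 (trans n≡n′p (cong (_* p) n′≡0))
  n′<n : n′ < n
  n′<n = quotient-< p∣n {{prime⇒nonTrivial pp}} {{≢-nonZero n≢0}}
... | m , n′≡pᵏm , p∤m = m , (begin
  n                     ≡⟨ n≡n′p ⟩
  n′ * p                ≡⟨ *-comm n′ p ⟩
  p * n′                ≡⟨ cong (p *_) n′≡pᵏm ⟩
  p * (p ^ ν′ f p n′ * m) ≡⟨ *-assoc p _ m ⟨
  p * p ^ ν′ f p n′ * m  ∎) , p∤m
  where open ≡-Reasoning

ν-decomposition : Prime p → n ≢ 0 → ∃[ m ] n ≡ p ^ ν p n * m × p ∤ m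
ν-decomposition {n = n} pp n≢0 = ν′-decomposition n pp n≢0 ≤-refl

pᵏm≡pʲm′⇒k≡j : Prime p → ∀ k j {m m′} → p ^ k * m ≡ p ^ j * m′ →
  p ∤ m → p ∤ m′ → k ≡ j
pᵏm≡pʲm′⇒k≡j pp zero zero _ _ _ = refl
pᵏm≡pʲm′⇒k≡j {p} pp zero (suc j) {m} {m′} eq p∤m _ =
  contradiction (divides (p ^ j * m′) (trans (sym (+-identityʳ m)) (trans eq
    (trans (*-assoc p _ m′) (*-comm p _))))) p∤m
pᵏm≡pʲm′⇒k≡j pp (suc k) zero eq p∤m p∤m′ =
  contradiction (pᵏm≡pʲm′⇒k≡j pp zero (suc k) (sym eq) p∤m′ p∤m) λ ()
pᵏm≡pʲm′⇒k≡j {p} pp (suc k) (suc j) {m} {m′} eq p∤m p∤m′ =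
  cong suc (pᵏm≡pʲm′⇒k≡j pp k j
    (*-cancelˡ-≡ _ _ p {{prime⇒nonZero pp}}
      (trans (sym (*-assoc p _ m)) (trans eq (*-assoc p _ m′)))) p∤m p∤m′)

n≡pᵏm⇒ν≡k : Prime p → n ≢ 0 → n ≡ p ^ k * m → p ∤ m → ν p n ≡ k
n≡pᵏm⇒ν≡k pp n≢0 eq p∤m with ν-decomposition pp n≢0
... | m′ , eq′ , p∤m′ = pᵏm≡pʲm′⇒k≡j pp _ _ (trans (sym eq′) eq) p∤m′ p∤m

∤⇒ν≡0 : Prime p → n ≢ 0 → p ∤ n → ν p n ≡ 0
∤⇒ν≡0 {n = n} pp n≢0 = n≡pᵏm⇒ν≡k pp n≢0 (sym (+-identityʳ n))

ν-* : Prime p → m ≢ 0 → n ≢ 0 → ν p (m * n) ≡ ν p m + ν p n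
ν-* {p} {m} {n} pp m≢0 n≢0
  with ν-decomposition pp m≢0 | ν-decomposition pp n≢0
... | m′ , m≡ , p∤m′ | n′ , n≡ , p∤n′ = n≡pᵏm⇒ν≡k pp (*-≢0 m≢0 n≢0) mn≡ p∤m′n′
  where
  open ≡-Reasoning
  mn≡ : m * n ≡ p ^ (ν p m + ν p n) * (m′ * n′)
  mn≡ = begin
    m * n                               ≡⟨ cong₂ _*_ m≡ n≡ ⟩
    (p ^ ν p m * m′) * (p ^ ν p n * n′) ≡⟨ [m*n]*[o*p]≡[m*o]*[n*p] (p ^ ν p m) m′ _ n′ ⟩
    (p ^ ν p m * p ^ ν p n) * (m′ * n′) ≡⟨ cong (_* (m′ * n′)) (^-distribˡ-+-* p (ν p m) _) ⟨
    p ^ (ν p m + ν p n) * (m′ * n′)     ∎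
  p∤m′n′ : p ∤ m′ * n′
  p∤m′n′ p∣m′n′ with euclidsLemma m′ n′ pp p∣m′n′
  ... | inj₁ p∣m′ = p∤m′ p∣m′
  ... | inj₂ p∣n′ = p∤n′ p∣n′

ν-1 : Prime p → ν p 1 ≡ 0
ν-1 pp = ∤⇒ν≡0 pp (λ ()) (prime∤1 pp)

ν-^ : ∀ k → Prime p → n ≢ 0 → ν p (n ^ k) ≡ k * ν p n
ν-^ zero    pp n≢0 = ν-1 pp
ν-^ {p} {n} (suc k) pp n≢0 =
  trans (ν-* pp n≢0 (^-≢0 k n≢0)) (cong (ν p n +_) (ν-^ k pp n≢0))

ν-self : Prime p → ν p p ≡ 1
ν-self {p} pp =
  n≡pᵏm⇒ν≡k pp (prime≢0 pp) (sym (trans (*-identityʳ _) (*-identityʳ p))) (prime∤1 pp)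

∣⇒ν-≤ : Prime p → n ≢ 0 → m ∣ n → ν p m ≤ ν p n
∣⇒ν-≤ {p} {n} {m} pp n≢0 (divides c n≡cm) =
  subst (ν p m ≤_) (sym (trans (cong (ν p) n≡cm) (ν-* pp c≢0 m≢0))) (m≤n+m _ _)
  where
  c≢0 : c ≢ 0
  c≢0 c≡0 = n≢0 (trans n≡cm (cong (_* m) c≡0))
  m≢0 : m ≢ 0
  m≢0 m≡0 = n≢0 (trans n≡cm (trans (cong (c *_) m≡0) (*-zeroʳ c)))

^-monoʳ-∣ : ∀ p → j ≤ k → p ^ j ∣ p ^ k
^-monoʳ-∣ {j} {k} p j≤k = divides (p ^ (k ∸ j))
  (trans (cong (p ^_) (sym (m∸n+n≡m j≤k))) (^-distribˡ-+-* p (k ∸ j) j))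

≤ν⇒^∣ : Prime p → n ≢ 0 → j ≤ ν p n → p ^ j ∣ n
≤ν⇒^∣ {p} {n} {j} pp n≢0 j≤ν with ν-decomposition pp n≢0
... | m , n≡ , _ = subst (p ^ j ∣_) (sym n≡) (∣m⇒∣m*n m (^-monoʳ-∣ p j≤ν))

^∣⇒≤ν : Prime p → n ≢ 0 → p ^ j ∣ n → j ≤ ν p n
^∣⇒≤ν {p} {n} {j} pp n≢0 pʲ∣n with ν-decomposition pp n≢0
... | m , n≡ , p∤m = ≮⇒≥ ν<j⇒p∣m
  where
  pᵛ⁺¹ : p ^ suc (ν p n) ≡ p ^ ν p n * p
  pᵛ⁺¹ = *-comm p _
  ν<j⇒p∣m : ¬ ν p n < j
  ν<j⇒p∣m ν<j = p∤m (*-cancelˡ-∣ (p ^ ν p n) {{≢-nonZero (^-≢0 (ν p n) (prime≢0 pp))}}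
    (subst₂ _∣_ pᵛ⁺¹ n≡ (∣-trans (^-monoʳ-∣ p ν<j) pʲ∣n)))

1≤ν⇒∣ : Prime p → n ≢ 0 → 1 ≤ ν p n → p ∣ n
1≤ν⇒∣ {p} pp n≢0 1≤ν = subst (_∣ _) (*-identityʳ p) (≤ν⇒^∣ pp n≢0 1≤ν)

∣⇒1≤ν : Prime p → n ≢ 0 → p ∣ n → 1 ≤ ν p n
∣⇒1≤ν {p} pp n≢0 p∣n = ^∣⇒≤ν pp n≢0 (subst (_∣ _) (sym (*-identityʳ p)) p∣n)

productOfPrimes-≢0 : ∀ {ps} → All Prime ps → product ps ≢ 0
productOfPrimes-≢0 {ps} ps-prime = ≢-nonZero⁻¹ (product ps) {{productOfPrimes≢0 ps-prime}}

productOfPrimes-∣ : ∀ {B} ps → All Prime ps → B ≢ 0 →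
  (∀ q → Prime q → ν q (product ps) ≤ ν q B) → product ps ∣ B
productOfPrimes-∣ {B} [] _ _ _ = 1∣ B
productOfPrimes-∣ {B} (p ∷ ps) (pp ∷ ps-prime) B≢0 ν≤ =
  subst (p * P ∣_) (sym B≡tP) (*-monoˡ-∣ P p∣t)
  where
  P = product ps
  P≢0 = productOfPrimes-≢0 ps-prime
  P∣B : P ∣ B
  P∣B = productOfPrimes-∣ ps ps-prime B≢0 λ q qp →
    ≤-trans (∣⇒ν-≤ qp (*-≢0 (prime≢0 pp) P≢0) (n∣m*n p)) (ν≤ q qp)
  t = quotient P∣B
  B≡tP : B ≡ t * P
  B≡tP = m∣n⇒n≡quotient*m P∣B
  t≢0 : t ≢ 0
  t≢0 t≡0 = B≢0 (trans B≡tP (cong (_* P) t≡0))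
  1+νP≤νt+νP : 1 + ν p P ≤ ν p t + ν p P
  1+νP≤νt+νP = subst₂ _≤_
    (trans (ν-* pp (prime≢0 pp) P≢0) (cong (_+ ν p P) (ν-self pp)))
    (trans (cong (ν p) B≡tP) (ν-* pp t≢0 P≢0))
    (ν≤ p pp)
  p∣t : p ∣ t
  p∣t = 1≤ν⇒∣ pp t≢0 (+-cancelʳ-≤ (ν p P) 1 _ 1+νP≤νt+νP)

ν-≤⇒∣ : m ≢ 0 → n ≢ 0 → (∀ p → Prime p → ν p m ≤ ν p n) → m ∣ n
ν-≤⇒∣ {m} m≢0 n≢0 ν≤ = subst (_∣ _) (sym m≡∏) (productOfPrimes-∣ ps ps-prime n≢0
  (λ p pp → subst (λ k → ν p k ≤ _) m≡∏ (ν≤ p pp)))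
  where
  open PrimeFactorisation (factorise m {{≢-nonZero m≢0}})
    renaming (factors to ps; isFactorisation to m≡∏; factorsPrime to ps-prime)

-- Radicals

ν-productOfDistinctPrimes≤1 : ∀ {ps} → All Prime ps → Unique ps → Prime p →
  ν p (product ps) ≤ 1
ν-productOfDistinctPrimes≤1 [] [] pp = ≤-trans (≤-reflexive (ν-1 pp)) z≤n
ν-productOfDistinctPrimes≤1 {p} {q ∷ ps} (qp ∷ ps-prime) (q∉ps ∷ ps-unique) pp =
  subst (_≤ 1) (sym (ν-* pp (prime≢0 qp) P≢0)) (bound (p ≟ q))
  where
  P = product ps
  P≢0 = productOfPrimes-≢0 ps-prime
  bound : Dec (p ≡ q) → ν p q + ν p P ≤ 1
  bound (yes refl) = ≤-reflexive (cong₂ _+_ (ν-self pp) (∤⇒ν≡0 pp P≢0 p∤P))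
    where
    p∤P : p ∤ P
    p∤P p∣P = All.lookup q∉ps (factorisationHasAllPrimeFactors pp p∣P ps-prime) refl
  bound (no p≢q) = subst (λ k → k + ν p P ≤ 1) (sym (∤⇒ν≡0 pp (prime≢0 qp) p∤q))
    (ν-productOfDistinctPrimes≤1 ps-prime ps-unique pp)
    where
    p∤q : p ∤ q
    p∤q p∣q with prime⇒irreducible qp p∣q
    ... | inj₁ p≡1 = prime∤1 pp (subst (_∣ 1) (sym p≡1) ∣-refl)
    ... | inj₂ p≡q = p≢q p≡q

module _ (n : ℕ) where

  private
    radFactors = filter (λ p → prime? p ×-dec (p ∣? n)) (upTo (suc n))
    radFactors-spec : All (λ p → Prime p × p ∣ n) radFactors
    radFactors-spec = All.all-filter (λ p → prime? p ×-dec (p ∣? n)) (upTo (suc n))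
    radFactors-prime : All Prime radFactors
    radFactors-prime = All.map proj₁ radFactors-spec

  rad-≢0 : rad n ≢ 0
  rad-≢0 = productOfPrimes-≢0 radFactors-prime

  ν-rad≤1 : Prime p → ν p (rad n) ≤ 1
  ν-rad≤1 = ν-productOfDistinctPrimes≤1 radFactors-prime
    (Unique.filter⁺ (λ p → prime? p ×-dec (p ∣? n)) (Unique.upTo⁺ (suc n)))

  prime∣rad⇒∣ : Prime p → p ∣ rad n → p ∣ n
  prime∣rad⇒∣ pp p∣rad =
    proj₂ (All.lookup radFactors-spec (factorisationHasAllPrimeFactors pp p∣rad radFactors-prime))

-- Valuations at an S-primitive point

min[3α,2β]≤α+β : ∀ {γ} α β → γ ≤ 3 * α → γ ≤ 2 * β → ¬ (2 ≤ α × 3 ≤ β) → γ ≤ α + β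
min[3α,2β]≤α+β 0        _            γ≤3α _    _    = ≤-trans γ≤3α z≤n
min[3α,2β]≤α+β 1        0            _    γ≤2β _    = ≤-trans γ≤2β z≤n
min[3α,2β]≤α+β 1        1            _    γ≤2β _    = γ≤2β
min[3α,2β]≤α+β 1        (2+ _)       γ≤3α _    _    = ≤-trans γ≤3α (s≤s (s≤s (s≤s z≤n)))
min[3α,2β]≤α+β (2+ _)   0            _    γ≤2β _    = ≤-trans γ≤2β z≤n
min[3α,2β]≤α+β (2+ _)   1            _    γ≤2β _    = ≤-trans γ≤2β (s≤s (s≤s z≤n))
min[3α,2β]≤α+β (2+ _)   2            _    γ≤2β _    = ≤-trans γ≤2β (+-monoˡ-≤ 2 (s≤s (s≤s z≤n)))
min[3α,2β]≤α+β (2+ _)   (suc (2+ _)) _    _    ¬big =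
  contradiction (s≤s (s≤s z≤n) , s≤s (s≤s (s≤s z≤n))) ¬big

γ+ρ≤α+β+δ : ∀ {γ} α β {δ ρ} → γ ≤ 3 * α → γ ≤ δ → ρ ≤ 1 → (1 ≤ ρ → 1 ≤ 3 * α + 2 * β + δ) →
  γ + ρ ≤ α + β + δ
γ+ρ≤α+β+δ {γ} α β {δ} {0} _ γ≤δ _ _ =
  ≤-trans (≤-reflexive (+-identityʳ γ)) (≤-trans γ≤δ (m≤n+m δ (α + β)))
γ+ρ≤α+β+δ _ _ {ρ = 2+ _} _ _ (s≤s ()) _
γ+ρ≤α+β+δ {γ} α β {δ} {1} γ≤3α γ≤δ _ 1≤ν =
  subst (_≤ α + β + δ) (+-comm 1 γ) (1+γ≤ α β γ≤3α γ≤δ (1≤ν ≤-refl))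
  where
  1+γ≤ : ∀ {γ} α β {δ} → γ ≤ 3 * α → γ ≤ δ → 1 ≤ 3 * α + 2 * β + δ → suc γ ≤ α + β + δ
  1+γ≤ 0       0       z≤n _   1≤δ = 1≤δ
  1+γ≤ 0       (suc _) z≤n _   _   = s≤s z≤n
  1+γ≤ (suc α) β {δ}   _   γ≤δ _   = s≤s (≤-trans γ≤δ (m≤n+m δ (α + β)))

-- At p ∣ N primitivity gives ν p g ≤ ν p X + ν p Y, and ν p (rad n) ≤ 1 ≤ ν p N; at p ∤ N
-- the S-unit A is prime to p, so ν p g ≤ ν p D, and a p dividing rad n divides X, Y or D.
gcd*rad∣ : ∀ {X Y A D N n} → X ≢ 0 → Y ≢ 0 → A ≢ 0 → D ≢ 0 → N ≢ 0 →
  (∀ {p} → Prime p → p ∣ A → p ∣ N) →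
  (∀ {p} → Prime p → p ∣ N → ¬ ((p ^ 6 ∣ X ^ 3) × (p ^ 6 ∣ Y ^ 2))) →
  gcd (X ^ 3) (Y ^ 2) ∣ A * D →
  n ∣ X ^ 3 * Y ^ 2 * (A * D) →
  gcd (X ^ 3) (Y ^ 2) * rad n ∣ X * Y * (N * D)
gcd*rad∣ {X} {Y} {A} {D} {N} {n} X≢0 Y≢0 A≢0 D≢0 N≢0 A-S-unit S-primitive g∣AD n∣X³Y²AD =
  ν-≤⇒∣ (*-≢0 g≢0 (rad-≢0 n)) (*-≢0 (*-≢0 X≢0 Y≢0) (*-≢0 N≢0 D≢0)) local
  where
  g = gcd (X ^ 3) (Y ^ 2)
  g≢0 : g ≢ 0
  g≢0 = gcd[m,n]≢0 _ _ (inj₁ (^-≢0 3 X≢0))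
  X³≢0 = ^-≢0 3 X≢0
  Y²≢0 = ^-≢0 2 Y≢0
  AD≢0 = *-≢0 A≢0 D≢0
  local : ∀ p → Prime p → ν p (g * rad n) ≤ ν p (X * Y * (N * D))
  local p pp = subst₂ _≤_ (sym (ν-* pp g≢0 (rad-≢0 n))) (sym ν-XYND) (split (p ∣? N))
    where
    α = ν p X
    β = ν p Y
    γ = ν p g
    ρ = ν p (rad n)
    ν-X³ : ν p (X ^ 3) ≡ 3 * α
    ν-X³ = ν-^ 3 pp X≢0
    ν-Y² : ν p (Y ^ 2) ≡ 2 * β
    ν-Y² = ν-^ 2 pp Y≢0
    ν-XYND : ν p (X * Y * (N * D)) ≡ α + β + (ν p N + ν p D)
    ν-XYND = trans (ν-* pp (*-≢0 X≢0 Y≢0) (*-≢0 N≢0 D≢0))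
                   (cong₂ _+_ (ν-* pp X≢0 Y≢0) (ν-* pp N≢0 D≢0))
    γ≤3α : γ ≤ 3 * α
    γ≤3α = subst (γ ≤_) ν-X³ (∣⇒ν-≤ pp X³≢0 (gcd[m,n]∣m (X ^ 3) (Y ^ 2)))
    γ≤2β : γ ≤ 2 * β
    γ≤2β = subst (γ ≤_) ν-Y² (∣⇒ν-≤ pp Y²≢0 (gcd[m,n]∣n (X ^ 3) (Y ^ 2)))
    split : Dec (p ∣ N) → γ + ρ ≤ α + β + (ν p N + ν p D)
    split (yes p∣N) = +-mono-≤ (min[3α,2β]≤α+β α β γ≤3α γ≤2β not-both)
      (≤-trans (ν-rad≤1 n pp) (≤-trans (∣⇒1≤ν pp N≢0 p∣N) (m≤m+n _ _)))
      where
      pᵏ∣ : ∀ k {m} → m ≢ 0 → 6 ≤ k * ν p m → p ^ 6 ∣ m ^ k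
      pᵏ∣ k m≢0 6≤kν = ≤ν⇒^∣ pp (^-≢0 k m≢0) (subst (6 ≤_) (sym (ν-^ k pp m≢0)) 6≤kν)
      not-both : ¬ (2 ≤ α × 3 ≤ β)
      not-both (2≤α , 3≤β) = S-primitive pp p∣N
        (pᵏ∣ 3 X≢0 (*-monoʳ-≤ 3 2≤α) , pᵏ∣ 2 Y≢0 (*-monoʳ-≤ 2 3≤β))
    split (no p∤N) = ≤-trans (γ+ρ≤α+β+δ α β γ≤3α γ≤δ (ν-rad≤1 n pp) 1≤ρ⇒1≤ν)
      (+-monoʳ-≤ (α + β) (m≤n+m _ (ν p N)))
      where
      ν-AD≡δ : ν p (A * D) ≡ ν p D
      ν-AD≡δ = trans (ν-* pp A≢0 D≢0) (cong (_+ ν p D) (∤⇒ν≡0 pp A≢0 (p∤N ∘ A-S-unit pp)))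
      γ≤δ : γ ≤ ν p D
      γ≤δ = subst (γ ≤_) ν-AD≡δ (∣⇒ν-≤ pp AD≢0 g∣AD)
      1≤ρ⇒1≤ν : 1 ≤ ρ → 1 ≤ 3 * α + 2 * β + ν p D
      1≤ρ⇒1≤ν 1≤ρ = subst (1 ≤_) ν-X³Y²AD
        (∣⇒1≤ν pp (*-≢0 (*-≢0 X³≢0 Y²≢0) AD≢0)
          (∣-trans (prime∣rad⇒∣ n pp (1≤ν⇒∣ pp (rad-≢0 n) 1≤ρ)) n∣X³Y²AD))
        where
        ν-X³Y²AD : ν p (X ^ 3 * Y ^ 2 * (A * D)) ≡ 3 * α + 2 * β + ν p D
        ν-X³Y²AD = trans (ν-* pp (*-≢0 X³≢0 Y²≢0) AD≢0)
          (cong₂ _+_ (trans (ν-* pp X³≢0 Y²≢0) (cong₂ _+_ ν-X³ ν-Y²)) ν-AD≡δ)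

^≡*⇒∣^ : ∀ {X A D N} k c .{{_ : NonZero k}} .{{_ : NonZero c}} → X ≢ 0 → A ≢ 0 → D ≢ 0 → N ≢ 0 →
  (∀ {p} → Prime p → p ∣ A → p ∣ N) →
  (∀ {p} → Prime p → p ∣ N → p ^ (k * suc c) ∤ X ^ k) →
  X ^ k ≡ A * D → X ∣ (N * D) ^ c
^≡*⇒∣^ {X} {A} {D} {N} k c X≢0 A≢0 D≢0 N≢0 A-S-unit S-primitive Xᵏ≡AD =
  ν-≤⇒∣ X≢0 (^-≢0 c (*-≢0 N≢0 D≢0)) local
  where
  local : ∀ p → Prime p → ν p X ≤ ν p ((N * D) ^ c)
  local p pp = subst (ν p X ≤_) (sym ν-[ND]ᶜ) (split (p ∣? N))
    where
    α = ν p X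
    ν-[ND]ᶜ : ν p ((N * D) ^ c) ≡ c * (ν p N + ν p D)
    ν-[ND]ᶜ = trans (ν-^ c pp (*-≢0 N≢0 D≢0)) (cong (c *_) (ν-* pp N≢0 D≢0))
    ν-Xᵏ : ν p (X ^ k) ≡ k * α
    ν-Xᵏ = ν-^ k pp X≢0
    split : Dec (p ∣ N) → α ≤ c * (ν p N + ν p D)
    split (yes p∣N) = ≤-trans α≤c (m≤m*n c (ν p N + ν p D) {{≢-nonZero νN+νD≢0}})
      where
      α≤c : α ≤ c
      α≤c = ≮⇒≥ λ c<α → S-primitive pp p∣N
        (≤ν⇒^∣ pp (^-≢0 k X≢0) (subst (k * suc c ≤_) (sym ν-Xᵏ) (*-monoʳ-≤ k c<α)))
      νN+νD≢0 : ν p N + ν p D ≢ 0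
      νN+νD≢0 = m<n⇒n≢0 (≤-trans (∣⇒1≤ν pp N≢0 p∣N) (m≤m+n _ _))
    split (no p∤N) = begin
      α                    ≤⟨ m≤n*m α k ⟩
      k * α                ≡⟨ trans (sym ν-Xᵏ) (trans (cong (ν p) Xᵏ≡AD) (ν-* pp A≢0 D≢0)) ⟩
      ν p A + ν p D        ≡⟨ cong (_+ ν p D) (∤⇒ν≡0 pp A≢0 (p∤N ∘ A-S-unit pp)) ⟩
      ν p D                ≤⟨ m≤n+m (ν p D) (ν p N) ⟩
      ν p N + ν p D        ≤⟨ m≤n*m _ c ⟩
      c * (ν p N + ν p D)  ∎
      where open ≤-Reasoning

-- Powers of the abc constant kn / kd

^-distribʳ-* : ∀ m n k → (m * n) ^ k ≡ m ^ k * n ^ k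
^-distribʳ-* m n zero    = refl
^-distribʳ-* m n (suc k) = begin
  m * n * (m * n) ^ k     ≡⟨ cong (m * n *_) (^-distribʳ-* m n k) ⟩
  m * n * (m ^ k * n ^ k) ≡⟨ [m*n]*[o*p]≡[m*o]*[n*p] m n (m ^ k) (n ^ k) ⟩
  m * m ^ k * (n * n ^ k) ∎
  where open ≡-Reasoning

^-cancelʳ-≤ : ∀ {m n} k .{{_ : NonZero k}} → m ^ k ≤ n ^ k → m ≤ n
^-cancelʳ-≤ k mᵏ≤nᵏ = ≮⇒≥ λ n<m → <⇒≱ (^-monoˡ-< k n<m) mᵏ≤nᵏ

[aⁱbʲ]ᵏ : ∀ a i b j k → (a ^ i * b ^ j) ^ k ≡ a ^ (i * k) * b ^ (j * k)
[aⁱbʲ]ᵏ a i b j k =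
  trans (^-distribʳ-* (a ^ i) (b ^ j) k) (cong₂ _*_ (^-*-assoc a i k) (^-*-assoc b j k))

module Bounds (kn kd : ℕ) where

  -- m ^ q ≤ (kn / kd) ^ u · r ^ w, with denominators cleared as in ABC
  record Bound (m q u r w : ℕ) : Set where
    constructor bound
    field
      bound-≤ : m ^ q * kd ^ u ≤ kn ^ u * r ^ w

  Bound-^ : ∀ {m q u r w} k → Bound m q u r w → Bound m (q * k) (u * k) r (w * k)
  Bound-^ {m} {q} {u} {r} {w} k (bound b) = bound $
    subst₂ _≤_ ([aⁱbʲ]ᵏ m q kd u k) ([aⁱbʲ]ᵏ kn u r w k) (^-monoˡ-≤ k b)

  Bound-root : ∀ {m q u r w} k .{{_ : NonZero k}} →
    Bound m (q * k) (u * k) r (w * k) → Bound m q u r w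
  Bound-root {m} {q} {u} {r} {w} k (bound b) = bound $
    ^-cancelʳ-≤ k (subst₂ _≤_ (sym ([aⁱbʲ]ᵏ m q kd u k)) (sym ([aⁱbʲ]ᵏ kn u r w k)) b)

  Bound-mono : ∀ {m m′ q u r r′ w} → m′ ≤ m → r ≤ r′ → Bound m q u r w → Bound m′ q u r′ w
  Bound-mono {q = q} {u} {w = w} m′≤m r≤r′ (bound b) = bound $
    ≤-trans (*-monoˡ-≤ (kd ^ u) (^-monoˡ-≤ q m′≤m))
      (≤-trans b (*-monoʳ-≤ (kn ^ u) (^-monoˡ-≤ w r≤r′)))

  Bound-base : ∀ {T Z q u r w} c → T ^ c ≤ Z → Bound Z q u r w → Bound T (c * q) u r w
  Bound-base {T} {Z} {q} {u} c Tᶜ≤Z (bound b) = bound $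
    ≤-trans (*-monoˡ-≤ (kd ^ u) (subst (_≤ Z ^ q) (^-*-assoc T c q) (^-monoˡ-≤ q Tᶜ≤Z))) b

  Bound-pad : ∀ {m q u u′ r w} → kd ≤ kn → u ≤ u′ → Bound m q u r w → Bound m q u′ r w
  Bound-pad {m} {q} {u} {u′} {r} {w} kd≤kn u≤u′ (bound b) = bound $ begin
    m ^ q * kd ^ u′                   ≡⟨ cong (λ t → m ^ q * kd ^ t) u′≡ ⟩
    m ^ q * kd ^ (u + d)              ≡⟨ cong (m ^ q *_) (^-distribˡ-+-* kd u d) ⟩
    m ^ q * (kd ^ u * kd ^ d)         ≡⟨ *-assoc (m ^ q) _ _ ⟨
    m ^ q * kd ^ u * kd ^ d           ≤⟨ *-mono-≤ b (^-monoˡ-≤ d kd≤kn) ⟩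
    kn ^ u * r ^ w * kn ^ d           ≡⟨ x*y*z≡x*z*y (kn ^ u) (r ^ w) (kn ^ d) ⟩
    kn ^ u * kn ^ d * r ^ w           ≡⟨ cong (_* r ^ w) (^-distribˡ-+-* kn u d) ⟨
    kn ^ (u + d) * r ^ w              ≡⟨ cong (λ t → kn ^ t * r ^ w) u′≡ ⟨
    kn ^ u′ * r ^ w                   ∎
    where
    open ≤-Reasoning
    d = u′ ∸ u
    u′≡ : u′ ≡ u + d
    u′≡ = sym (m+[n∸m]≡n u≤u′)
    x*y*z≡x*z*y : ∀ x y z → x * y * z ≡ x * z * y
    x*y*z≡x*z*y = solve-∀

  Bound-growʳ : ∀ {m q u r w w′} .{{_ : NonZero r}} → w ≤ w′ → Bound m q u r w → Bound m q u r w′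
  Bound-growʳ {u = u} {r = r} w≤w′ (bound b) = bound $
    ≤-trans b (*-monoʳ-≤ (kn ^ u) (^-monoʳ-≤ r w≤w′))

  Bound-0 : ∀ {q u r w} .{{_ : NonZero q}} → Bound 0 q u r w
  Bound-0 {suc q} = bound z≤n

  ≤^⇒Bound : ∀ {T M q u w} c .{{_ : NonZero M}} → kd ≤ kn → T ≤ M ^ c → c * q ≤ w →
    Bound T q u M w
  ≤^⇒Bound {T} {M} {q} {u} {w} c kd≤kn T≤Mᶜ cq≤w = bound $ begin
    T ^ q * kd ^ u       ≤⟨ *-mono-≤ (^-monoˡ-≤ q T≤Mᶜ) (^-monoˡ-≤ u kd≤kn) ⟩
    (M ^ c) ^ q * kn ^ u ≡⟨ cong (_* kn ^ u) (^-*-assoc M c q) ⟩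
    M ^ (c * q) * kn ^ u ≤⟨ *-monoˡ-≤ (kn ^ u) (^-monoʳ-≤ M cq≤w) ⟩
    M ^ w * kn ^ u       ≡⟨ *-comm (M ^ w) (kn ^ u) ⟩
    kn ^ u * M ^ w       ∎
    where open ≤-Reasoning

  Bound⇒kd≤kn : ∀ {m q r w} .{{_ : NonZero m}} .{{_ : NonZero q}} → r ^ w ≤ m ^ q →
    Bound m q q r w → kd ≤ kn
  Bound⇒kd≤kn {m} {q} {r} {w} rʷ≤mᵠ (bound b) =
    ^-cancelʳ-≤ q (*-cancelʳ-≤ (kd ^ q) (kn ^ q) (m ^ q) {{m^n≢0 m q}} (begin
      kd ^ q * m ^ q ≡⟨ *-comm (kd ^ q) (m ^ q) ⟩
      m ^ q * kd ^ q ≤⟨ b ⟩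
      kn ^ q * r ^ w ≤⟨ *-monoʳ-≤ (kn ^ q) rʷ≤mᵠ ⟩
      kn ^ q * m ^ q ∎))
    where open ≤-Reasoning

  Bound-scale : ∀ {m q e r} g .{{_ : NonZero g}} →
    Bound m q q r (q + e) → Bound (m * g) q q (g * r) (q + e)
  Bound-scale {m} {q} {e} {r} g (bound b) = bound $ begin
    (m * g) ^ q * kd ^ q                 ≡⟨ cong (_* kd ^ q) (^-distribʳ-* m g q) ⟩
    m ^ q * g ^ q * kd ^ q               ≡⟨ x*y*z≡y*[x*z] (m ^ q) (g ^ q) (kd ^ q) ⟩
    g ^ q * (m ^ q * kd ^ q)             ≤⟨ *-mono-≤ (^-monoʳ-≤ g (m≤m+n q e)) b ⟩
    g ^ (q + e) * (kn ^ q * r ^ (q + e)) ≡⟨ x*[y*z]≡y*[x*z] (g ^ (q + e)) (kn ^ q) (r ^ (q + e)) ⟩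
    kn ^ q * (g ^ (q + e) * r ^ (q + e)) ≡⟨ cong (kn ^ q *_) (^-distribʳ-* g r (q + e)) ⟨
    kn ^ q * (g * r) ^ (q + e)           ∎
    where
    open ≤-Reasoning
    x*y*z≡y*[x*z] : ∀ x y z → x * y * z ≡ y * (x * z)
    x*y*z≡y*[x*z] = solve-∀
    x*[y*z]≡y*[x*z] : ∀ x y z → x * (y * z) ≡ y * (x * z)
    x*[y*z]≡y*[x*z] = solve-∀

  Bound-eliminate : ∀ {Z W M q r e} .{{_ : NonZero Z}} → W ^ 6 ≤ Z ^ 5 →
    q * 6 ≡ r + 5 * (q + e) →
    Bound Z q q (W * M) (q + e) → Bound Z r (q * 6) M ((q + e) * 6)
  Bound-eliminate {Z} {W} {M} {q} {r} {e} W⁶≤Z⁵ q6≡ b = bound $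
    *-cancelʳ-≤ _ _ (Z ^ (5 * (q + e))) {{m^n≢0 Z (5 * (q + e))}} (begin
      Z ^ r * kd ^ (q * 6) * Z ^ (5 * (q + e))
        ≡⟨ x*y*z≡x*z*y (Z ^ r) (kd ^ (q * 6)) (Z ^ (5 * (q + e))) ⟩
      Z ^ r * Z ^ (5 * (q + e)) * kd ^ (q * 6)
        ≡⟨ cong (_* kd ^ (q * 6)) (trans (cong (Z ^_) q6≡) (^-distribˡ-+-* Z r _)) ⟨
      Z ^ (q * 6) * kd ^ (q * 6)
        ≤⟨ Bound.bound-≤ (Bound-^ 6 b) ⟩
      kn ^ (q * 6) * (W * M) ^ ((q + e) * 6)
        ≡⟨ cong (kn ^ (q * 6) *_) (^-distribʳ-* W M ((q + e) * 6)) ⟩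
      kn ^ (q * 6) * (W ^ ((q + e) * 6) * M ^ ((q + e) * 6))
        ≡⟨ x*[y*z]≡x*z*y (kn ^ (q * 6)) (W ^ ((q + e) * 6)) (M ^ ((q + e) * 6)) ⟩
      kn ^ (q * 6) * M ^ ((q + e) * 6) * W ^ ((q + e) * 6)
        ≡⟨ cong (λ t → kn ^ (q * 6) * M ^ ((q + e) * 6) * W ^ t) (*-comm (q + e) 6) ⟩
      kn ^ (q * 6) * M ^ ((q + e) * 6) * W ^ (6 * (q + e))
        ≡⟨ cong (kn ^ (q * 6) * M ^ ((q + e) * 6) *_) (^-*-assoc W 6 (q + e)) ⟨
      kn ^ (q * 6) * M ^ ((q + e) * 6) * (W ^ 6) ^ (q + e)
        ≤⟨ *-monoʳ-≤ (kn ^ (q * 6) * M ^ ((q + e) * 6)) (^-monoˡ-≤ (q + e) W⁶≤Z⁵) ⟩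
      kn ^ (q * 6) * M ^ ((q + e) * 6) * (Z ^ 5) ^ (q + e)
        ≡⟨ cong (kn ^ (q * 6) * M ^ ((q + e) * 6) *_) (^-*-assoc Z 5 (q + e)) ⟩
      kn ^ (q * 6) * M ^ ((q + e) * 6) * Z ^ (5 * (q + e)) ∎)
    where
    open ≤-Reasoning
    x*y*z≡x*z*y : ∀ x y z → x * y * z ≡ x * z * y
    x*y*z≡x*z*y = solve-∀
    x*[y*z]≡x*z*y : ∀ x y z → x * (y * z) ≡ x * z * y
    x*[y*z]≡x*z*y = solve-∀

  Bound-transfer : ∀ {T Z M q r u v w w′} c .{{_ : NonZero (c * r)}} .{{_ : NonZero M}} →
    kd ≤ kn → T ^ c ≤ Z → u * q ≤ v * (c * r) → w * q ≤ w′ * (c * r) →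
    Bound Z r u M w → Bound T q v M w′
  Bound-transfer {T} {Z} {M} {q} {r} {u} {v} {w} {w′} c kd≤kn Tᶜ≤Z uq≤ wq≤ b =
    Bound-root (c * r)
      (subst (λ t → Bound T t (v * (c * r)) M (w′ * (c * r))) (c*[r*q]≡q*[c*r] c r q) $
       Bound-base c Tᶜ≤Z (Bound-growʳ wq≤ (Bound-pad kd≤kn uq≤ (Bound-^ q b))))
    where
    c*[r*q]≡q*[c*r] : ∀ c r q → c * (r * q) ≡ q * (c * r)
    c*[r*q]≡q*[c*r] = solve-∀

-- abc for triples that are not coprime

∣i^n∣≡∣i∣^n : ∀ i n → ∣ i ℤ.^ n ∣ ≡ ∣ i ∣ ^ n
∣i^n∣≡∣i∣^n i zero    = refl
∣i^n∣≡∣i∣^n i (suc n) = trans (ℤ.abs-* i (i ℤ.^ n)) (cong (∣ i ∣ *_) (∣i^n∣≡∣i∣^n i n))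

gcd-cofactors : ∀ u v → ∣ u ∣ ≢ 0 → ∃[ u′ ] ∃[ v′ ]
  u ≡ u′ ℤ.* (ℤ.+ gcd ∣ u ∣ ∣ v ∣) × v ≡ v′ ℤ.* (ℤ.+ gcd ∣ u ∣ ∣ v ∣) × gcd ∣ u′ ∣ ∣ v′ ∣ ≡ 1
gcd-cofactors u v ∣u∣≢0
  with ℤ∣.divides u′ u≡ ← ℤ∣.∣ᵤ⇒∣ {ℤ.+ gcd ∣ u ∣ ∣ v ∣} {u} (gcd[m,n]∣m ∣ u ∣ ∣ v ∣)
     | ℤ∣.divides v′ v≡ ← ℤ∣.∣ᵤ⇒∣ {ℤ.+ gcd ∣ u ∣ ∣ v ∣} {v} (gcd[m,n]∣n ∣ u ∣ ∣ v ∣)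
  = u′ , v′ , u≡ , v≡ , GCD.unique (gcd-GCD ∣ u′ ∣ ∣ v′ ∣) (GCD-* {{≢-nonZero g≢0}} scaled)
  where
  g = gcd ∣ u ∣ ∣ v ∣
  g≢0 : g ≢ 0
  g≢0 = gcd[m,n]≢0 ∣ u ∣ ∣ v ∣ (inj₁ ∣u∣≢0)
  scaled : GCD (∣ u′ ∣ * g) (∣ v′ ∣ * g) (1 * g)
  scaled = subst₂ (λ U V → GCD U V (1 * g))
    (trans (cong ∣_∣ u≡) (ℤ.abs-* u′ (ℤ.+ g))) (trans (cong ∣_∣ v≡) (ℤ.abs-* v′ (ℤ.+ g)))
    (subst (GCD ∣ u ∣ ∣ v ∣) (sym (*-identityˡ g)) (gcd-GCD ∣ u ∣ ∣ v ∣))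

module _ {e q kn kd : ℕ} (abc : ABC e q kn kd) where
  open Bounds kn kd

  abc-nonCoprime : ∀ {u v w U V W} → ∣ u ∣ ≡ U → ∣ v ∣ ≡ V → ∣ w ∣ ≡ W →
    U ≢ 0 → V ≢ 0 → W ≢ 0 → u ℤ.+ w ≡ v →
    ∃[ n ] Bound (U ⊔ V ⊔ W) q q (gcd U V * rad n) (q + e) × (gcd U V ∣ W) × (n ∣ U * V * W)
  abc-nonCoprime {u} {v} {w} refl refl refl ∣u∣≢0 ∣v∣≢0 ∣w∣≢0 u+w≡v
    with u′ , v′ , u≡ , v≡ , coprime ← gcd-cofactors u v ∣u∣≢0
    = u′v′w′
    , Bound-mono (≤-reflexive max≡) ≤-refl (Bound-scale g {{≢-nonZero g≢0}} (bound abc-cofactors))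
        , divides ∣ w′ ∣ ∣w∣≡
        , subst (_∣ (∣ u ∣ * ∣ v ∣ * ∣ w ∣)) (sym u′v′w′≡)
            (*-pres-∣ (*-pres-∣ (cofactor-∣ u′ ∣u∣≡) (cofactor-∣ v′ ∣v∣≡)) (cofactor-∣ w′ ∣w∣≡))
    where
    g = gcd ∣ u ∣ ∣ v ∣
    g≢0 : g ≢ 0
    g≢0 = gcd[m,n]≢0 ∣ u ∣ ∣ v ∣ (inj₁ ∣u∣≢0)
    w′ = v′ - u′
    w≡ : w ≡ w′ ℤ.* (ℤ.+ g)
    w≡ = begin
      w                               ≡⟨ w≡[u+w]-u u w ⟩
      (u ℤ.+ w) - u                   ≡⟨ cong (_- u) u+w≡v ⟩
      v - u                           ≡⟨ cong₂ _-_ v≡ u≡ ⟩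
      v′ ℤ.* (ℤ.+ g) - u′ ℤ.* (ℤ.+ g)     ≡⟨ factor v′ u′ (ℤ.+ g) ⟩
      w′ ℤ.* (ℤ.+ g)                    ∎
      where
      open ≡-Reasoning
      w≡[u+w]-u : ∀ u w → w ≡ (u ℤ.+ w) - u
      w≡[u+w]-u = ℤ-Solver.solve-∀
      factor : ∀ v′ u′ g → v′ ℤ.* g - u′ ℤ.* g ≡ (v′ - u′) ℤ.* g
      factor = ℤ-Solver.solve-∀
    ∣·g∣ : ∀ {z} z′ → z ≡ z′ ℤ.* (ℤ.+ g) → ∣ z ∣ ≡ ∣ z′ ∣ * g
    ∣·g∣ z′ z≡ = trans (cong ∣_∣ z≡) (ℤ.abs-* z′ (ℤ.+ g))
    ∣u∣≡ : ∣ u ∣ ≡ ∣ u′ ∣ * g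
    ∣u∣≡ = ∣·g∣ u′ u≡
    ∣v∣≡ : ∣ v ∣ ≡ ∣ v′ ∣ * g
    ∣v∣≡ = ∣·g∣ v′ v≡
    ∣w∣≡ : ∣ w ∣ ≡ ∣ w′ ∣ * g
    ∣w∣≡ = ∣·g∣ w′ w≡
    cofactor-≢0 : ∀ {Z} z′ → Z ≢ 0 → Z ≡ ∣ z′ ∣ * g → z′ ≢ 0ℤ
    cofactor-≢0 _ Z≢0 Z≡ z′≡0 = Z≢0 (trans Z≡ (cong (λ t → ∣ t ∣ * g) z′≡0))
    cofactor-∣ : ∀ {Z} z′ → Z ≡ ∣ z′ ∣ * g → ∣ z′ ∣ ∣ Z
    cofactor-∣ z′ Z≡ = divides g (trans Z≡ (*-comm ∣ z′ ∣ g))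
    -v′≢0 : - v′ ≢ 0ℤ
    -v′≢0 = cofactor-≢0 (- v′) ∣v∣≢0 (trans ∣v∣≡ (cong (_* g) (sym (ℤ.∣-i∣≡∣i∣ v′))))
    coprime′ : gcd (gcd ∣ u′ ∣ ∣ - v′ ∣) ∣ w′ ∣ ≡ 1
    coprime′ = trans (cong (λ t → gcd (gcd ∣ u′ ∣ t) ∣ w′ ∣) (ℤ.∣-i∣≡∣i∣ v′))
               (trans (cong (λ t → gcd t ∣ w′ ∣) coprime) (gcd-zeroˡ ∣ w′ ∣))
    sum≡0 : ∀ u′ v′ → u′ ℤ.+ - v′ ℤ.+ (v′ - u′) ≡ 0ℤ
    sum≡0 = ℤ-Solver.solve-∀
    abc-cofactors = abc u′ (- v′) w′ (cofactor-≢0 u′ ∣u∣≢0 ∣u∣≡) -v′≢0 (cofactor-≢0 w′ ∣w∣≢0 ∣w∣≡)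
          coprime′ (sum≡0 u′ v′)
    u′v′w′ = ∣ u′ ℤ.* - v′ ℤ.* w′ ∣
    u′v′w′≡ : u′v′w′ ≡ ∣ u′ ∣ * ∣ v′ ∣ * ∣ w′ ∣
    u′v′w′≡ = trans (ℤ.abs-* (u′ ℤ.* - v′) w′)
           (cong (_* ∣ w′ ∣) (trans (ℤ.abs-* u′ (- v′)) (cong (∣ u′ ∣ *_) (ℤ.∣-i∣≡∣i∣ v′))))
    max≡ : ∣ u ∣ ⊔ ∣ v ∣ ⊔ ∣ w ∣ ≡ (∣ u′ ∣ ⊔ ∣ - v′ ∣ ⊔ ∣ w′ ∣) * g
    max≡ = begin
      ∣ u ∣ ⊔ ∣ v ∣ ⊔ ∣ w ∣
        ≡⟨ cong₂ _⊔_ (cong₂ _⊔_ ∣u∣≡ ∣v∣≡) ∣w∣≡ ⟩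
      ∣ u′ ∣ * g ⊔ ∣ v′ ∣ * g ⊔ ∣ w′ ∣ * g
        ≡⟨ cong (_⊔ ∣ w′ ∣ * g) (*-distribʳ-⊔ g ∣ u′ ∣ ∣ v′ ∣) ⟨
      (∣ u′ ∣ ⊔ ∣ v′ ∣) * g ⊔ ∣ w′ ∣ * g
        ≡⟨ *-distribʳ-⊔ g (∣ u′ ∣ ⊔ ∣ v′ ∣) ∣ w′ ∣ ⟨
      (∣ u′ ∣ ⊔ ∣ v′ ∣ ⊔ ∣ w′ ∣) * g
        ≡⟨ cong (λ t → (∣ u′ ∣ ⊔ t ⊔ ∣ w′ ∣) * g) (ℤ.∣-i∣≡∣i∣ v′) ⟨
      (∣ u′ ∣ ⊔ ∣ - v′ ∣ ⊔ ∣ w′ ∣) * g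
        ∎
      where open ≡-Reasoning

-- The curve y² = x³ + aD

[xy]⁶≤[x³⊔y²]⁵ : ∀ X Y → (X * Y) ^ 6 ≤ (X ^ 3 ⊔ Y ^ 2) ^ 5
[xy]⁶≤[x³⊔y²]⁵ X Y = begin
  (X * Y) ^ 6               ≡⟨ ^-distribʳ-* X Y 6 ⟩
  X ^ 6 * Y ^ 6             ≡⟨ cong₂ _*_ (^-*-assoc X 3 2) (^-*-assoc Y 2 3) ⟨
  (X ^ 3) ^ 2 * (Y ^ 2) ^ 3 ≤⟨ *-mono-≤ (^-monoˡ-≤ 2 (m≤m⊔n (X ^ 3) (Y ^ 2)))
                                        (^-monoˡ-≤ 3 (m≤n⊔m (X ^ 3) (Y ^ 2))) ⟩
  Z ^ 2 * Z ^ 3             ≡⟨ ^-distribˡ-+-* Z 2 3 ⟨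
  Z ^ 5                     ∎
  where
  open ≤-Reasoning
  Z = X ^ 3 ⊔ Y ^ 2

6^[q+e]≤9^q : ∀ {e s q} → q ≡ 10 * e + s → 6 ^ (q + e) ≤ 9 ^ q
6^[q+e]≤9^q {e} {s} refl = begin
  6 ^ (10 * e + s + e)  ≡⟨ cong (6 ^_) (regroup e s) ⟩
  6 ^ (11 * e + s)      ≡⟨ ^-distribˡ-+-* 6 (11 * e) s ⟩
  6 ^ (11 * e) * 6 ^ s  ≡⟨ cong (_* 6 ^ s) (^-*-assoc 6 11 e) ⟨
  (6 ^ 11) ^ e * 6 ^ s  ≤⟨ *-mono-≤ (^-monoˡ-≤ e (≤ᵇ⇒≤ (6 ^ 11) (9 ^ 10) tt))
                                   (^-monoˡ-≤ s (≤ᵇ⇒≤ 6 9 tt)) ⟩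
  (9 ^ 10) ^ e * 9 ^ s  ≡⟨ cong (_* 9 ^ s) (^-*-assoc 9 10 e) ⟩
  9 ^ (10 * e) * 9 ^ s  ≡⟨ ^-distribˡ-+-* 9 (10 * e) s ⟨
  9 ^ (10 * e + s)      ∎
  where
  open ≤-Reasoning
  regroup : ∀ e s → 10 * e + s + e ≡ 11 * e + s
  regroup = solve-∀

q*6≡r+5[q+e] : ∀ {e s q} → q ≡ 10 * e + s → q * 6 ≡ (5 * e + s) + 5 * (q + e)
q*6≡r+5[q+e] {e} {s} refl = identity e s
  where
  identity : ∀ e s → (10 * e + s) * 6 ≡ 5 * e + s + 5 * (10 * e + s + e)
  identity = solve-∀

exponents-transfer : ∀ {e s q} c k → c * k ≡ 6 → q ≡ 10 * e + s →
  q * 6 * q ≤ k * (q + 10 * e) * (c * (5 * e + s)) ×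
  (q + e) * 6 * q ≤ k * (q + 12 * e) * (c * (5 * e + s))
exponents-transfer {e} {s} c k ck≡6 refl =
  slack (30 * (e * s)) (trans (×6 (q + 10 * e)) (identity₁ e s)) ,
  slack (36 * (e * s)) (trans (×6 (q + 12 * e)) (identity₂ e s))
  where
  q = 10 * e + s
  r = 5 * e + s
  regroup : ∀ k x c r → k * x * (c * r) ≡ c * k * (x * r)
  regroup = solve-∀
  ×6 : ∀ x → k * x * (c * r) ≡ 6 * (x * r)
  ×6 x = trans (regroup k x c r) (cong (_* (x * r)) ck≡6)
  identity₁ : ∀ e s → 6 * ((10 * e + s + 10 * e) * (5 * e + s))
                      ≡ (10 * e + s) * 6 * (10 * e + s) + 30 * (e * s)
  identity₁ = solve-∀
  identity₂ : ∀ e s → 6 * ((10 * e + s + 12 * e) * (5 * e + s))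
                      ≡ (10 * e + s + e) * 6 * (10 * e + s) + 36 * (e * s)
  identity₂ = solve-∀
  slack : ∀ {a b} m → b ≡ a + m → a ≤ b
  slack m refl = m≤m+n _ m

SUnitInt⇒∣NS : ∀ {S a p} → SUnitInt S a → Prime p → p ∣ ∣ a ∣ → p ∣ NS S
SUnitInt⇒∣NS (_ , a-S) pp p∣a = ∈⇒∣product (a-S _ pp p∣a)

SPrimitive-∣NS : ∀ {S p} x y → All Prime S → SPrimitive S x y → Prime p → p ∣ NS S →
  ¬ ((p ^ 6 ∣ ∣ x ∣ ^ 3) × (p ^ 6 ∣ ∣ y ∣ ^ 2))
SPrimitive-∣NS _ _ S-prime primitive-xy pp p∣N (d₁ , d₂) =
  primitive-xy (_ , factorisationHasAllPrimeFactors pp p∣N S-prime , d₁ , d₂)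

module WeakHall {e q kn kd : ℕ} (1≤e : 1 ≤ e) (10e≤q : 10 * e ≤ q)
  (abc : ABC e q kn kd) {S : List ℕ} (S-prime : All Prime S) {D a : ℤ} (D≢0 : D ≢ 0ℤ)
  (a-unit : SUnitInt S a) where

  open Bounds kn kd

  s = q ∸ 10 * e
  r = 5 * e + s
  q≡ : q ≡ 10 * e + s
  q≡ = sym (m+[n∸m]≡n 10e≤q)

  A = ∣ a ∣
  Dn = ∣ D ∣
  N = NS S
  M = N * Dn

  A≢0 : A ≢ 0
  A≢0 = proj₁ a-unit ∘ ℤ.∣i∣≡0⇒i≡0
  Dn≢0 : Dn ≢ 0
  Dn≢0 = D≢0 ∘ ℤ.∣i∣≡0⇒i≡0
  AD≢0 : A * Dn ≢ 0
  AD≢0 = *-≢0 A≢0 Dn≢0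
  N≢0 : N ≢ 0
  N≢0 = productOfPrimes-≢0 S-prime
  M≢0 : M ≢ 0
  M≢0 = *-≢0 N≢0 Dn≢0

  A-S-unit : ∀ {p} → Prime p → p ∣ A → p ∣ N
  A-S-unit = SUnitInt⇒∣NS a-unit

  instance
    q-nonZero : NonZero q
    q-nonZero = >-nonZero (≤-trans 1≤e (≤-trans (m≤n*m e 10) 10e≤q))
    r-nonZero : NonZero r
    r-nonZero = >-nonZero (≤-trans 1≤e (≤-trans (m≤n*m e 5) (m≤m+n (5 * e) s)))
    M-nonZero : NonZero M
    M-nonZero = ≢-nonZero M≢0

  -- abc for the triple (1, 8, −9), of radical 6
  kd≤kn : kd ≤ kn
  kd≤kn = Bound⇒kd≤kn {9} {q} {6} {q + e} {{_}} (6^[q+e]≤9^q q≡)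
    (bound (abc (ℤ.+ 1) (ℤ.+ 8) (ℤ.-[1+ 8 ]) (λ ()) (λ ()) (λ ()) refl refl))

  HallBound : ℤ → ℤ → Set
  HallBound x y = Bound (∣ x ∣) q (2 * (q + 10 * e)) M (2 * (q + 12 * e))
                × Bound (∣ y ∣) q (3 * (q + 10 * e)) M (3 * (q + 12 * e))

  cq≤k[q+12e] : ∀ c k → c ≤ k → c * q ≤ k * (q + 12 * e)
  cq≤k[q+12e] c k c≤k = *-mono-≤ c≤k (m≤m+n q (12 * e))

  x≡0-case : ∀ {y} → y ℤ.^ 2 ≡ 0ℤ ℤ.^ 3 ℤ.+ a ℤ.* D → SPrimitive S 0ℤ y → HallBound 0ℤ y
  x≡0-case {y} curve primitive-xy =
    Bound-0 , ≤^⇒Bound 2 kd≤kn (∣⇒≤ {{m^n≢0 M 2}} Y∣M²) (cq≤k[q+12e] 2 3 (s≤s (s≤s z≤n)))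
    where
    Y²≡AD : ∣ y ∣ ^ 2 ≡ A * Dn
    Y²≡AD = trans (sym (∣i^n∣≡∣i∣^n y 2))
      (trans (cong ∣_∣ (trans curve (ℤ.+-identityˡ (a ℤ.* D)))) (ℤ.abs-* a D))
    Y≢0 : ∣ y ∣ ≢ 0
    Y≢0 Y≡0 = AD≢0 (trans (sym Y²≡AD) (cong (_^ 2) Y≡0))
    Y∣M² : ∣ y ∣ ∣ M ^ 2
    Y∣M² = ^≡*⇒∣^ 2 2 Y≢0 A≢0 Dn≢0 N≢0 A-S-unit
      (λ pp p∣N p⁶∣Y² → SPrimitive-∣NS 0ℤ y S-prime primitive-xy pp p∣N (_ ∣0 , p⁶∣Y²)) Y²≡AD

  y≡0-case : ∀ {x} → 0ℤ ℤ.^ 2 ≡ x ℤ.^ 3 ℤ.+ a ℤ.* D → SPrimitive S x 0ℤ → HallBound x 0ℤ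
  y≡0-case {x} curve primitive-xy =
    ≤^⇒Bound 1 kd≤kn (∣⇒≤ {{m^n≢0 M 1}} X∣M) (cq≤k[q+12e] 1 2 (s≤s z≤n)) , Bound-0
    where
    x³≡-aD : x ℤ.^ 3 ≡ - (a ℤ.* D)
    x³≡-aD = ℤ.i-j≡0⇒i≡j (x ℤ.^ 3) (- (a ℤ.* D))
      (trans (cong (λ t → x ℤ.^ 3 ℤ.+ t) (ℤ.neg-involutive (a ℤ.* D))) (sym curve))
    X³≡AD : ∣ x ∣ ^ 3 ≡ A * Dn
    X³≡AD = trans (sym (∣i^n∣≡∣i∣^n x 3))
      (trans (cong ∣_∣ x³≡-aD) (trans (ℤ.∣-i∣≡∣i∣ (a ℤ.* D)) (ℤ.abs-* a D)))
    X≢0 : ∣ x ∣ ≢ 0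
    X≢0 X≡0 = AD≢0 (trans (sym X³≡AD) (cong (_^ 3) X≡0))
    X∣M : ∣ x ∣ ∣ M ^ 1
    X∣M = ^≡*⇒∣^ 3 1 X≢0 A≢0 Dn≢0 N≢0 A-S-unit
      (λ pp p∣N p⁶∣X³ → SPrimitive-∣NS x 0ℤ S-prime primitive-xy pp p∣N (p⁶∣X³ , _ ∣0)) X³≡AD

  generic-case : ∀ {x y} → ∣ x ∣ ≢ 0 → ∣ y ∣ ≢ 0 → y ℤ.^ 2 ≡ x ℤ.^ 3 ℤ.+ a ℤ.* D →
    SPrimitive S x y → HallBound x y
  generic-case {x} {y} X≢0 Y≢0 curve primitive-xy
    with n , bound-by-gR , g∣AD , n∣X³Y²AD ← abc-nonCoprime abc {x ℤ.^ 3} {y ℤ.^ 2} {a ℤ.* D}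
           (∣i^n∣≡∣i∣^n x 3) (∣i^n∣≡∣i∣^n y 2) (ℤ.abs-* a D)
           (^-≢0 3 X≢0) (^-≢0 2 Y≢0) AD≢0 (sym curve)
    = transfer 3 2 refl (m≤m⊔n (X ^ 3) (Y ^ 2)) , transfer 2 3 refl (m≤n⊔m (X ^ 3) (Y ^ 2))
    where
    X = ∣ x ∣
    Y = ∣ y ∣
    Z = X ^ 3 ⊔ Y ^ 2
    gR∣XYM : gcd (X ^ 3) (Y ^ 2) * rad n ∣ X * Y * M
    gR∣XYM = gcd*rad∣ X≢0 Y≢0 A≢0 Dn≢0 N≢0 A-S-unit
      (SPrimitive-∣NS x y S-prime primitive-xy) g∣AD n∣X³Y²AD
    Z≢0 : Z ≢ 0
    Z≢0 = m<n⇒n≢0 (≤-trans (n≢0⇒n>0 (^-≢0 3 X≢0)) (m≤m⊔n (X ^ 3) (Y ^ 2)))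
    bound-by-XYM : Bound Z q q (X * Y * M) (q + e)
    bound-by-XYM = Bound-mono (m≤m⊔n Z (A * Dn))
      (∣⇒≤ {{≢-nonZero (*-≢0 (*-≢0 X≢0 Y≢0) M≢0)}} gR∣XYM) bound-by-gR
    bound-by-M : Bound Z r (q * 6) M ((q + e) * 6)
    bound-by-M = Bound-eliminate {W = X * Y} {e = e} {{≢-nonZero Z≢0}}
      ([xy]⁶≤[x³⊔y²]⁵ X Y) (q*6≡r+5[q+e] {e} {s} q≡) bound-by-XYM
    transfer : ∀ {T} c k .{{_ : NonZero c}} → c * k ≡ 6 → T ^ c ≤ Z →
      Bound T q (k * (q + 10 * e)) M (k * (q + 12 * e))
    transfer c k ck≡6 Tᶜ≤Z with u≤ , w≤ ← exponents-transfer c k ck≡6 q≡ =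
      Bound-transfer c {{m*n≢0 c r}} kd≤kn Tᶜ≤Z u≤ w≤ bound-by-M

  weak-hall : ∀ x y → y ℤ.^ 2 ≡ x ℤ.^ 3 ℤ.+ a ℤ.* D → SPrimitive S x y → HallBound x y
  weak-hall x y with x ℤ.≟ 0ℤ | y ℤ.≟ 0ℤ
  ... | yes refl | _        = x≡0-case {y}
  ... | no _     | yes refl = y≡0-case {x}
  ... | no x≢0   | no y≢0   = generic-case {x} {y} (x≢0 ∘ ℤ.∣i∣≡0⇒i≡0) (y≢0 ∘ ℤ.∣i∣≡0⇒i≡0)

theorem2p3 : (e q kn kd : ℕ) → 1 ≤ e → 10 ℕ.* e ≤ q → 1 ≤ kn → 1 ≤ kd →
  ABC e q kn kd →
  (S : List ℕ) → All Prime S → Unique S →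
  (D : ℤ) → D ≢ 0ℤ →
  (x y a : ℤ) → SUnitInt S a →
  y ℤ.^ 2 ≡ x ℤ.^ 3 ℤ.+ a ℤ.* D →
  SPrimitive S x y →
  (∣ x ∣ ℕ.^ q ℕ.* kd ℕ.^ (2 ℕ.* (q ℕ.+ 10 ℕ.* e))
     ≤ kn ℕ.^ (2 ℕ.* (q ℕ.+ 10 ℕ.* e)) ℕ.* (NS S ℕ.* ∣ D ∣) ℕ.^ (2 ℕ.* (q ℕ.+ 12 ℕ.* e)))
  × (∣ y ∣ ℕ.^ q ℕ.* kd ℕ.^ (3 ℕ.* (q ℕ.+ 10 ℕ.* e))
     ≤ kn ℕ.^ (3 ℕ.* (q ℕ.+ 10 ℕ.* e)) ℕ.* (NS S ℕ.* ∣ D ∣) ℕ.^ (3 ℕ.* (q ℕ.+ 12 ℕ.* e)))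
theorem2p3 e q kn kd 1≤e 10e≤q _ _ abc S S-prime _ D D≢0 x y a a-unit curve primitive-xy =
  map Bounds.Bound.bound-≤ Bounds.Bound.bound-≤ (weak-hall x y curve primitive-xy)
  where open WeakHall 1≤e 10e≤q abc S-prime D≢0 a-unit
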